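{- For every integer $n \geq 1$, let $\mathcal{U}(n;123)$ denote the set of set partitions $\Pi$ of $[n]=\{1,\dots,n\}$ such that $\mathrm{Flatten}(\Pi)$ avoids the pattern $123$. Then $|\mathcal{U}(1;123)|=1$, $|\mathcal{U}(2;123)|=2$, $|\mathcal{U}(3;123)|=1$, and $|\mathcal{U}(n;123)|=0$ for all $n\geq 4$.
   Context: A set partition $\Pi$ of $[n]$ is written in standard increasing form: the entries within each block are listed in increasing order, and the blocks are listed in increasing order of their smallest (first) entries. $\mathrm{Flatten}(\Pi)$ is the permutation of $[n]$ (in one-line notation) obtained by concatenating the blocks of $\Pi$ written in this standard increasing form, i.e. erasing the dividers between blocks; e.g. $\Pi = 136\text{ - }279\text{ - }4\text{ - }58$ gives $\mathrm{Flatten}(\Pi)=136279458$. A permutation $p=p_1\cdots p_n$ avoids a pattern $\pi=\pi_1\cdots\pi_m$ (a permutation of $[m]$) if there are no indices $i_1<\dots<i_m$ such that $p_{i_1},\dots,p_{i_m}$ are in the same relative order as $\pi_1,\dots,\pi_m$. -}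

module Defs where

open import Data.Nat using (ℕ; suc; _<_)
open import Data.Fin using (Fin)
open import Data.List using (List; []; _∷_; concat; map; upTo; length; lookup)
open import Data.List.Relation.Unary.All using (All)
open import Data.List.Relation.Unary.Linked using (Linked)
open import Data.List.Relation.Unary.Unique.Propositional using (Unique)
open import Data.List.Relation.Binary.Permutation.Propositional using (_↭_)
open import Data.List.Membership.Propositional using (_∈_)
open import Data.Product using (Σ; _×_)
open import Data.Empty using (⊥)
open import Data.Unit using (⊤)
open import Function.Bundles using (_⇔_)
open import Relation.Binary.PropositionalEquality using (_≡_)

-- A set partition of [n] is represented by its standard increasing form:
-- a list of blocks, each block a list of naturals.
NonEmpty : List ℕ → Set
NonEmpty []      = ⊥
NonEmpty (_ ∷ _) = ⊤

FirstLess : List ℕ → List ℕ → Set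
FirstLess (x ∷ _) (y ∷ _) = x < y
FirstLess _       _       = ⊥

[_] : ℕ → List ℕ
[ n ] = map suc (upTo n)

record IsSetPartition (n : ℕ) (Π : List (List ℕ)) : Set where
  field
    blocksNonEmpty   : All NonEmpty Π
    blocksIncreasing : All (Linked _<_) Π
    firstsIncreasing : Linked FirstLess Π
    coversExactly    : concat Π ↭ [ n ]

Flatten : List (List ℕ) → List ℕ
Flatten = concat

Contains : List ℕ → List ℕ → Set
Contains p π =
  Σ (Fin (length π) → Fin (length p)) λ f →
    (∀ a b → a Data.Fin.< b → f a Data.Fin.< f b) ×
    (∀ a b → (lookup p (f a) < lookup p (f b)) ⇔ (lookup π a < lookup π b))

Avoids : List ℕ → List ℕ → Set
Avoids p π = Contains p π → ⊥

InU : ℕ → List ℕ → List (List ℕ) → Set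
InU n π Π = IsSetPartition n Π × Avoids (Flatten Π) π

HasCard : {A : Set} → (A → Set) → ℕ → Set
HasCard {A} P k =
  Σ (List A) λ L → Unique L × (∀ x → (x ∈ L) ⇔ P x) × length L ≡ k

-- Since 123 is an increasing pattern, containing it just means
-- having an increasing subsequence of length 3 (increasing-pattern, proved
-- for every strictly increasing pattern).  Such subsequences arise from
-- sublists x ∷ y ∷ z ∷ [] of the flattening with x < y < z, and cannot exist
-- in lists of length < 3 (pigeonhole) or in 132.
--
-- In a partition in standard form every block increases and the first
-- entries of the blocks increase, so an avoiding partition has at most two
-- blocks of at most two entries, the second block being a singleton c with
-- c ≤ b when the first block is ab (classify; five shapes).  Listing the
-- entries of each shape in increasing order gives a sorted rearrangement of
-- [n], which must be [n] itself; this pins down the partition for n ≤ 3 and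
-- is impossible for n ≥ 4 since a shape has at most three entries.
module Submission where

open import Defs
open import Data.Nat using (ℕ; _<_; _≤_; _≥_; _≤?_; z≤n; s≤s)
open import Data.Nat.Properties
  using (<-irrefl; <-asym; <-trans; ≤-refl; <⇒≤; <⇒≱; ≰⇒>; n≤1+n; ≤-totalOrder)
open import Data.Fin using (Fin; zero; suc)
import Data.Fin as F
import Data.Fin.Properties as F
open import Data.List using (List; []; _∷_; length; lookup; concat)
open import Data.List.Membership.Propositional using (_∈_)
open import Data.List.Relation.Unary.All using (All; []; _∷_)
open import Data.List.Relation.Unary.AllPairs using ([]; _∷_)
open import Data.List.Relation.Unary.Any using (here; there)
open import Data.List.Relation.Unary.Linked as Linked using (Linked; []; [-]; _∷_)
open import Data.List.Relation.Unary.Linked.Properties using (map⁺; applyUpTo⁺₁)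
open import Data.List.Relation.Unary.Sorted.TotalOrder.Properties using (↗↭↗⇒≋)
open import Data.List.Relation.Unary.Unique.Propositional using (Unique)
open import Data.List.Relation.Binary.Sublist.Propositional using (_⊆_; _∷_; _∷ʳ_; minimum)
open import Data.List.Relation.Binary.Sublist.Propositional.Properties using (++⁺ˡ)
open import Data.List.Relation.Binary.Permutation.Propositional
  using (_↭_; ↭-refl; ↭-sym; ↭-trans; prep; swap; ↭⇒↭ₛ)
open import Data.List.Relation.Binary.Pointwise using (Pointwise-≡⇒≡)
open import Data.Product using (Σ; _×_; _,_)
open import Data.Empty using (⊥; ⊥-elim)
open import Function.Base using (id; _∘_)
open import Function.Bundles using (_⇔_; mk⇔; Equivalence)
open import Function.Definitions using (Injective)
open import Relation.Binary.Core using (_Preserves_⟶_)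
open import Relation.Binary.Definitions using (tri<; tri≈; tri>)
open import Relation.Binary.PropositionalEquality using (_≡_; refl; sym; subst; subst₂)
open import Relation.Nullary using (yes; no)

record IncreasingSubseq (m : ℕ) (p : List ℕ) : Set where
  constructor increasingSubseq
  field
    position   : Fin m → Fin (length p)
    positionUp : position Preserves F._<_ ⟶ F._<_
    valueUp    : (lookup p ∘ position) Preserves F._<_ ⟶ _<_

increasing⇒reflects : ∀ {m} {v : Fin m → ℕ} → v Preserves F._<_ ⟶ _<_ →
                      ∀ {a b} → v a < v b → a F.< b
increasing⇒reflects up {a} {b} va<vb with F.<-cmp a b
... | tri< a<b _ _ = a<b
... | tri≈ _ refl _ = ⊥-elim (<-irrefl refl va<vb)
... | tri> _ _ b<a = ⊥-elim (<-asym va<vb (up b<a))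

linked⇒lookup-increasing : ∀ {xs : List ℕ} → Linked _<_ xs →
                           lookup xs Preserves F._<_ ⟶ _<_
linked⇒lookup-increasing {x ∷ xs} inc {zero} {suc j} _ =
  Linked.lookup <-trans (Linked.tail inc) (Linked.head′ inc) j
linked⇒lookup-increasing {x ∷ xs} inc {suc i} {suc j} (s≤s i<j) =
  linked⇒lookup-increasing (Linked.tail inc) i<j

-- For a strictly increasing pattern π, containing π means exactly having an
-- increasing subsequence of length |π|: both orders are then the order of Fin.
increasing-pattern : ∀ {p π : List ℕ} → Linked _<_ π →
                     Contains p π ⇔ IncreasingSubseq (length π) p
increasing-pattern {p} {π} π-up = mk⇔ toSubseq fromSubseq
  where
  πUp : lookup π Preserves F._<_ ⟶ _<_
  πUp = linked⇒lookup-increasing π-up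

  toSubseq : Contains p π → IncreasingSubseq (length π) p
  toSubseq (f , f-up , sameOrder) =
    increasingSubseq f (f-up _ _) (λ {a} {b} a<b → Equivalence.from (sameOrder a b) (πUp a<b))

  fromSubseq : IncreasingSubseq (length π) p → Contains p π
  fromSubseq (increasingSubseq f f-up v-up) = f , (λ _ _ → f-up) , λ _ _ →
    mk⇔ (πUp ∘ increasing⇒reflects v-up) (v-up ∘ increasing⇒reflects πUp)

embedding : ∀ {A : Set} {xs ys : List A} → xs ⊆ ys → Fin (length xs) → Fin (length ys)
embedding (y ∷ʳ τ) i       = suc (embedding τ i)
embedding (_ ∷ τ)  zero    = zero
embedding (_ ∷ τ)  (suc i) = suc (embedding τ i)

embedding-increasing : ∀ {A : Set} {xs ys : List A} (τ : xs ⊆ ys) →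
                       embedding τ Preserves F._<_ ⟶ F._<_
embedding-increasing (y ∷ʳ τ) i<j = s≤s (embedding-increasing τ i<j)
embedding-increasing (_ ∷ τ) {zero} {suc j} _ = s≤s z≤n
embedding-increasing (_ ∷ τ) {suc i} {suc j} (s≤s i<j) = s≤s (embedding-increasing τ i<j)

embedding-lookup : ∀ {A : Set} {xs ys : List A} (τ : xs ⊆ ys) i →
                   lookup ys (embedding τ i) ≡ lookup xs i
embedding-lookup (y ∷ʳ τ) i          = embedding-lookup τ i
embedding-lookup (refl ∷ τ) zero     = refl
embedding-lookup (refl ∷ τ) (suc i)  = embedding-lookup τ i

sublist⇒subseq : ∀ {xs ys : List ℕ} → xs ⊆ ys → Linked _<_ xs →
                 IncreasingSubseq (length xs) ys
sublist⇒subseq {xs} {ys} τ xs-up =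
  increasingSubseq (embedding τ) (embedding-increasing τ) valueUp
  where
  valueUp : (lookup ys ∘ embedding τ) Preserves F._<_ ⟶ _<_
  valueUp {i} {j} i<j =
    subst₂ _<_ (sym (embedding-lookup τ i)) (sym (embedding-lookup τ j))
      (linked⇒lookup-increasing xs-up i<j)

-- Strictly increasing positions are distinct, so an increasing subsequence
-- is no longer than the list (pigeonhole on Fin).
increasing⇒injective : ∀ {m n} {f : Fin m → Fin n} → f Preserves F._<_ ⟶ F._<_ →
                       Injective _≡_ _≡_ f
increasing⇒injective up {a} {b} fa≡fb with F.<-cmp a b
... | tri< a<b _ _ = ⊥-elim (F.<-irrefl fa≡fb (up a<b))
... | tri≈ _ a≡b _ = a≡b
... | tri> _ _ b<a = ⊥-elim (F.<-irrefl (sym fa≡fb) (up b<a))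

subseq-length : ∀ {m p} → IncreasingSubseq m p → m ≤ length p
subseq-length (increasingSubseq f f-up _) = F.injective⇒≤ (increasing⇒injective f-up)

pattern123 : List ℕ
pattern123 = 1 ∷ 2 ∷ 3 ∷ []

pattern123-increasing : Linked _<_ pattern123
pattern123-increasing = ≤-refl ∷ ≤-refl ∷ [-]

ascent⇒contains123 : ∀ {x y z p} → x < y → y < z → (x ∷ y ∷ z ∷ []) ⊆ p →
                     Contains p pattern123
ascent⇒contains123 x<y y<z τ =
  Equivalence.from (increasing-pattern pattern123-increasing) (sublist⇒subseq τ (x<y ∷ y<z ∷ [-]))

short-avoids123 : ∀ {p} → length p < 3 → Avoids p pattern123
short-avoids123 {p} short c =
  <⇒≱ short (subseq-length (Equivalence.to (increasing-pattern {p} pattern123-increasing) c))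

-- 132 avoids 123: three increasing positions in a list of length 3 are
-- 0, 1, 2, and the entries there are not increasing.
avoids132 : Avoids (1 ∷ 3 ∷ 2 ∷ []) pattern123
avoids132 c with Equivalence.to (increasing-pattern pattern123-increasing) c
... | increasingSubseq f f-up v-up = noAscent (f zero) (f (suc zero)) (f (suc (suc zero)))
        (f-up (s≤s z≤n)) (f-up (s≤s (s≤s z≤n))) (v-up (s≤s (s≤s z≤n)))
  where
  noAscent : (i j k : Fin 3) → i F.< j → j F.< k →
             lookup (1 ∷ 3 ∷ 2 ∷ []) j < lookup (1 ∷ 3 ∷ 2 ∷ []) k → ⊥
  noAscent _ (suc zero) (suc (suc zero)) _ _ (s≤s (s≤s ()))
  noAscent _ (suc zero) (suc zero) _ (s≤s ()) _
  noAscent _ (suc (suc zero)) (suc (suc zero)) _ (s≤s (s≤s ())) _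

-- The five forms (in standard form) of a partition avoiding 123:
-- ∅, a, ab, a-c, ab-c.  The second index lists the entries of the
-- partition in increasing order.
data Shape : List (List ℕ) → List ℕ → Set where
  noBlocks      : Shape [] []
  singleton     : ∀ a → Shape ((a ∷ []) ∷ []) (a ∷ [])
  pair          : ∀ {a b} → a < b → Shape ((a ∷ b ∷ []) ∷ []) (a ∷ b ∷ [])
  twoSingletons : ∀ {a c} → a < c → Shape ((a ∷ []) ∷ (c ∷ []) ∷ []) (a ∷ c ∷ [])
  pairSingleton : ∀ {a b c} → a < c → c ≤ b →
                  Shape ((a ∷ b ∷ []) ∷ (c ∷ []) ∷ []) (a ∷ c ∷ b ∷ [])

shape-sorted : ∀ {Π s} → Shape Π s → Linked _≤_ s
shape-sorted noBlocks            = []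
shape-sorted (singleton a)       = [-]
shape-sorted (pair a<b)          = <⇒≤ a<b ∷ [-]
shape-sorted (twoSingletons a<c) = <⇒≤ a<c ∷ [-]
shape-sorted (pairSingleton a<c c≤b) = <⇒≤ a<c ∷ c≤b ∷ [-]

shape-entries : ∀ {Π s} → Shape Π s → concat Π ↭ s
shape-entries noBlocks            = ↭-refl
shape-entries (singleton a)       = ↭-refl
shape-entries (pair _)            = ↭-refl
shape-entries (twoSingletons _)   = ↭-refl
shape-entries (pairSingleton {a} {b} {c} _ _) = prep a (swap b c ↭-refl)

-- Each excluded case exhibits an ascent x < y < z.
classify : ∀ Π → All NonEmpty Π → All (Linked _<_) Π → Linked FirstLess Π →
           Avoids (concat Π) pattern123 → Σ (List ℕ) (Shape Π)
classify [] _ _ _ _ = [] , noBlocks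
classify ((a ∷ b ∷ c ∷ _) ∷ _) _ ((a<b ∷ b<c ∷ _) ∷ _) _ avoid =
  ⊥-elim (avoid (ascent⇒contains123 a<b b<c (refl ∷ refl ∷ refl ∷ minimum _)))
classify ((a ∷ r₁) ∷ (c ∷ r₂) ∷ (e ∷ _) ∷ _) _ _ (a<c ∷ c<e ∷ _) avoid =
  ⊥-elim (avoid (ascent⇒contains123 a<c c<e
    (refl ∷ ++⁺ˡ r₁ (refl ∷ ++⁺ˡ r₂ (refl ∷ minimum _)))))
classify ((a ∷ r₁) ∷ (c ∷ d ∷ _) ∷ _) _ (_ ∷ (c<d ∷ _) ∷ _) (a<c ∷ _) avoid =
  ⊥-elim (avoid (ascent⇒contains123 a<c c<d (refl ∷ ++⁺ˡ r₁ (refl ∷ refl ∷ minimum _))))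
classify ((a ∷ []) ∷ []) _ _ _ _ = _ , singleton a
classify ((a ∷ b ∷ []) ∷ []) _ ((a<b ∷ _) ∷ _) _ _ = _ , pair a<b
classify ((a ∷ []) ∷ (c ∷ []) ∷ []) _ _ (a<c ∷ _) _ = _ , twoSingletons a<c
classify ((a ∷ b ∷ []) ∷ (c ∷ []) ∷ []) _ ((a<b ∷ _) ∷ _) (a<c ∷ _) avoid with c ≤? b
... | yes c≤b = _ , pairSingleton a<c c≤b
... | no c≰b  = ⊥-elim (avoid (ascent⇒contains123 a<b (≰⇒> c≰b) (refl ∷ refl ∷ refl ∷ minimum _)))
classify ([] ∷ _) (() ∷ _) _ _ _
classify (_ ∷ [] ∷ _) (_ ∷ () ∷ _) _ _ _
classify (_ ∷ _ ∷ [] ∷ _) (_ ∷ _ ∷ () ∷ _) _ _ _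

[n]-sorted : ∀ n → Linked _≤_ [ n ]
[n]-sorted n = map⁺ (applyUpTo⁺₁ id n (λ _ → s≤s (n≤1+n _)))

entries≡[n] : ∀ {n Π s} → Shape Π s → concat Π ↭ [ n ] → s ≡ [ n ]
entries≡[n] {n} shape cover = Pointwise-≡⇒≡ (↗↭↗⇒≋ ≤-totalOrder (shape-sorted shape) ([n]-sorted n)
  (↭⇒↭ₛ (↭-trans (↭-sym (shape-entries shape)) cover)))

shape-of : ∀ {n Π} → InU n pattern123 Π → Shape Π [ n ]
shape-of {n} {Π} (isPartition , avoid) =
  sortEntries (classify Π blocksNonEmpty blocksIncreasing firstsIncreasing avoid)
  where
  open IsSetPartition isPartition
  sortEntries : Σ (List ℕ) (Shape Π) → Shape Π [ n ]
  sortEntries (_ , shape) = subst (Shape Π) (entries≡[n] shape coversExactly) shape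

partition-1 partition-12 partition-1-2 partition-13-2 : List (List ℕ)
partition-1    = (1 ∷ []) ∷ []
partition-12   = (1 ∷ 2 ∷ []) ∷ []
partition-1-2  = (1 ∷ []) ∷ (2 ∷ []) ∷ []
partition-13-2 = (1 ∷ 3 ∷ []) ∷ (2 ∷ []) ∷ []

shapes-of-[1] : ∀ {Π} → Shape Π [ 1 ] → Π ∈ partition-1 ∷ []
shapes-of-[1] (singleton _) = here refl

shapes-of-[2] : ∀ {Π} → Shape Π [ 2 ] → Π ∈ partition-12 ∷ partition-1-2 ∷ []
shapes-of-[2] (pair _)          = here refl
shapes-of-[2] (twoSingletons _) = there (here refl)

shapes-of-[3] : ∀ {Π} → Shape Π [ 3 ] → Π ∈ partition-13-2 ∷ []
shapes-of-[3] (pairSingleton _ _) = here refl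

-- A shape has at most three entries, so none has entries [n] for n ≥ 4.
no-shape-of-large : ∀ {n Π} → n ≥ 4 → Shape Π [ n ] → ⊥
no-shape-of-large (s≤s (s≤s (s≤s (s≤s _)))) ()

partition-1∈U : InU 1 pattern123 partition-1
partition-1∈U = record
  { blocksNonEmpty = _ ∷ [] ; blocksIncreasing = [-] ∷ [] ; firstsIncreasing = [-]
  ; coversExactly = ↭-refl } , short-avoids123 (s≤s (s≤s z≤n))

partition-12∈U : InU 2 pattern123 partition-12
partition-12∈U = record
  { blocksNonEmpty = _ ∷ [] ; blocksIncreasing = (s≤s (s≤s z≤n) ∷ [-]) ∷ [] ; firstsIncreasing = [-]
  ; coversExactly = ↭-refl } , short-avoids123 (s≤s (s≤s (s≤s z≤n)))

partition-1-2∈U : InU 2 pattern123 partition-1-2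
partition-1-2∈U = record
  { blocksNonEmpty = _ ∷ _ ∷ [] ; blocksIncreasing = [-] ∷ [-] ∷ [] ; firstsIncreasing = s≤s (s≤s z≤n) ∷ [-]
  ; coversExactly = ↭-refl } , short-avoids123 (s≤s (s≤s (s≤s z≤n)))

partition-13-2∈U : InU 3 pattern123 partition-13-2
partition-13-2∈U = record
  { blocksNonEmpty = _ ∷ _ ∷ [] ; blocksIncreasing = (s≤s (s≤s z≤n) ∷ [-]) ∷ [-] ∷ []
  ; firstsIncreasing = s≤s (s≤s z≤n) ∷ [-] ; coversExactly = prep 1 (swap 3 2 ↭-refl) } , avoids132

enumerates : ∀ {A : Set} {P : A → Set} (L : List A) → Unique L →
             (∀ {x} → x ∈ L → P x) → (∀ {x} → P x → x ∈ L) → HasCard P (length L)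
enumerates L unique sound complete = L , unique , (λ _ → mk⇔ sound complete) , refl

mainTheorem1 : HasCard (InU 1 (1 ∷ 2 ∷ 3 ∷ [])) 1
    × HasCard (InU 2 (1 ∷ 2 ∷ 3 ∷ [])) 2
    × HasCard (InU 3 (1 ∷ 2 ∷ 3 ∷ [])) 1
    × ((n : ℕ) → n ≥ 4 → HasCard (InU n (1 ∷ 2 ∷ 3 ∷ [])) 0)
mainTheorem1 =
  enumerates (partition-1 ∷ []) ([] ∷ [])
    (λ { (here refl) → partition-1∈U }) (shapes-of-[1] ∘ shape-of) ,
  enumerates (partition-12 ∷ partition-1-2 ∷ []) (((λ ()) ∷ []) ∷ [] ∷ [])
    (λ { (here refl) → partition-12∈U ; (there (here refl)) → partition-1-2∈U })
    (shapes-of-[2] ∘ shape-of) ,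
  enumerates (partition-13-2 ∷ []) ([] ∷ [])
    (λ { (here refl) → partition-13-2∈U }) (shapes-of-[3] ∘ shape-of) ,
  λ n n≥4 → enumerates [] [] (λ ()) (⊥-elim ∘ no-shape-of-large n≥4 ∘ shape-of)
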